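{- Let $(D,r)$ be a rooted digraph reduced with respect to Rules 1–4. Then the tail of any cut-edge of $D$ is not the head of another cut-edge of $D$.
   Context: A rooted digraph $(D,r)$ is a finite digraph without loops or parallel arcs with a root $r$ of in-degree $0$. A cut-vertex is a vertex $v\ne r$ such that some vertex is unreachable from $r$ in $D-v$. A cut-edge is an arc $e$ such that some vertex is unreachable from $r$ in $D-e$. $N^-(x),N^+(x)$ denote in-/out-neighbourhoods. $D$ is reduced with respect to Rules 1–4 if: (1) every vertex is reachable from $r$; (2) no cut-vertex has exactly one incoming arc and no cut-vertex has exactly one outgoing arc; (3) there are no vertices $u_1,\dots,u_5$ with $N^+(u_i)=N^-(u_i)=\{u_{i-1},u_{i+1}\}$ for $i=2,3,4$; (4) there is no vertex $x$ with an in-neighbour $y$ such that every directed path from $r$ to $y$ contains a vertex of $N^-(x)\setminus\{y\}$. -}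

module Defs where

open import Data.Nat using (ℕ)
open import Data.Fin using (Fin)
open import Data.Bool using (Bool; true; false)
open import Data.List using (List; []; _∷_)
open import Data.List.Membership.Propositional using (_∈_)
open import Data.List.Relation.Unary.Unique.Propositional using (Unique)
open import Data.Product using (Σ; ∃; _×_; _,_; proj₁)
open import Data.Sum using (_⊎_)
open import Data.Unit using (⊤)
open import Relation.Nullary using (¬_)
open import Relation.Binary.PropositionalEquality using (_≡_)
open import Function.Bundles using (_⇔_)

-- A finite digraph on vertex set Fin n, given by a Boolean adjacency matrix
-- (so there are no parallel arcs); loops are excluded in the record.
record RootedDigraph : Set where
  field
    n     : ℕ
    adj   : Fin n → Fin n → Bool
    root  : Fin n
    loopless : ∀ v → adj v v ≡ false
    root-indeg0 : ∀ u → adj u root ≡ false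

module _ (D : RootedDigraph) where
  open RootedDigraph D

  V : Set
  V = Fin n

  Arc : V → V → Set
  Arc u v = adj u v ≡ true

  data Walk (okV : V → Set) (okA : V → V → Set) : V → V → Set where
    nil  : ∀ {x} → okV x → Walk okV okA x x
    cons : ∀ {x y z} → okV x → Arc x y → okA x y → Walk okV okA y z → Walk okV okA x z

  vertices : ∀ {okV okA x z} → Walk okV okA x z → List V
  vertices (nil {x} _) = x ∷ []
  vertices (cons {x} _ _ _ w) = x ∷ vertices w

  AnyV : V → Set
  AnyV _ = ⊤

  AnyA : V → V → Set
  AnyA _ _ = ⊤

  Path : V → V → Set
  Path x z = Σ (Walk AnyV AnyA x z) (λ w → Unique (vertices w))

  Reachable : V → Set
  Reachable u = Walk AnyV AnyA root u

  ReachableAvoidingV : V → V → Set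
  ReachableAvoidingV v u = Walk (λ w → ¬ (w ≡ v)) AnyA root u

  ReachableAvoidingA : V → V → V → Set
  ReachableAvoidingA a b u = Walk AnyV (λ x y → ¬ ((x ≡ a) × (y ≡ b))) root u

  CutVertex : V → Set
  CutVertex v = ¬ (v ≡ root) × Σ V (λ u → ¬ (u ≡ v) × ¬ ReachableAvoidingV v u)

  CutEdge : V → V → Set
  CutEdge a b = Arc a b × Σ V (λ u → ¬ ReachableAvoidingA a b u)

  ExactlyOneIn : V → Set
  ExactlyOneIn v = Σ V (λ u → ∀ w → (Arc w v ⇔ (w ≡ u)))

  ExactlyOneOut : V → Set
  ExactlyOneOut v = Σ V (λ u → ∀ w → (Arc v w ⇔ (w ≡ u)))

  NbhdIs : V → V → V → Set
  NbhdIs x p q = (∀ w → (Arc x w ⇔ (w ≡ p ⊎ w ≡ q))) × (∀ w → (Arc w x ⇔ (w ≡ p ⊎ w ≡ q)))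

  Rule1 : Set
  Rule1 = ∀ u → Reachable u

  Rule2 : Set
  Rule2 = ∀ v → CutVertex v → ¬ ExactlyOneIn v × ¬ ExactlyOneOut v

  Rule3 : Set
  Rule3 = ∀ u₁ u₂ u₃ u₄ u₅ → ¬ (NbhdIs u₂ u₁ u₃ × NbhdIs u₃ u₂ u₄ × NbhdIs u₄ u₃ u₅)

  Rule4 : Set
  Rule4 = ∀ x y → Arc y x →
    ¬ (∀ (P : Path root y) → Σ V (λ v → v ∈ vertices (proj₁ P) × Arc v x × ¬ (v ≡ y)))

  Reduced : Set
  Reduced = Rule1 × Rule2 × Rule3 × Rule4

module Submission where

-- Let a → b and c → a be cut-edges of a reduced rooted digraph (D , r); we
-- derive a contradiction with Rule 2 by showing that a is a cut-vertex with
-- exactly one incoming arc.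
--
--  * a is a cut-vertex: a ≠ r because r has in-degree 0, and any vertex cut
--    off by removing the arc a → b is also cut off by removing a (and it is
--    not a itself, since a walk to a can be stopped before it leaves a).
--  * c is the only in-neighbour of a: by rerouting, if the head a of the
--    cut-edge c → a were reachable without that arc, every vertex would be.
--    So for another in-neighbour w every path r ⇝ w passes through c (else
--    append w → a), and c is then the in-neighbour of a forbidden by Rule 4.

open import Data.Empty using (⊥-elim)
open import Data.Fin using (_≟_)
open import Data.List.Membership.Propositional using (_∈_; _∉_)
open import Data.List.Relation.Unary.Any using (here; there)
open import Data.Product using (Σ; _×_; _,_; proj₁; proj₂)
open import Data.Unit using (tt)
open import Function.Bundles using (mk⇔)
open import Relation.Nullary using (¬_; yes; no)
open import Relation.Binary.PropositionalEquality using (_≡_; refl; sym; trans)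

open import Defs

module _ (D : RootedDigraph) where
  open RootedDigraph D using (n; root; root-indeg0)
  open import Data.List.Membership.DecPropositional (_≟_ {n}) using (_∈?_)

  NotArc : V D → V D → V D → V D → Set
  NotArc a b x y = ¬ ((x ≡ a) × (y ≡ b))

  mapWalk : ∀ {P P′ : V D → Set} {Q Q′ : V D → V D → Set} {x z} →
            (∀ {v} → P v → P′ v) → (∀ {v w} → P v → Q v w → Q′ v w) →
            Walk D P Q x z → Walk D P′ Q′ x z
  mapWalk f g (nil p)        = nil (f p)
  mapWalk f g (cons p e q w) = cons (f p) e (g p q) (mapWalk f g w)

  snoc : ∀ {P : V D → Set} {Q : V D → V D → Set} {x y z} →
         Walk D P Q x y → P z → Arc D y z → Q y z → Walk D P Q x z
  snoc (nil p)          pz e q = cons p e q (nil pz)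
  snoc (cons p e′ q′ w) pz e q = cons p e′ q′ (snoc w pz e q)

  -- Stopping a walk at its first visit to its end a gives a walk to a that
  -- never leaves a, so it avoids every arc a → b.
  stopAtEnd : ∀ {a b x} → Walk D (AnyV D) (AnyA D) x a → Walk D (AnyV D) (NotArc a b) x a
  stopAtEnd (nil _) = nil tt
  stopAtEnd {a} {x = x} (cons _ e _ w) with x ≟ a
  ... | yes refl = nil tt
  ... | no x≢a   = cons tt e (λ q → x≢a (proj₁ q)) (stopAtEnd w)

  avoidVertex⇒avoidArc : ∀ {a b u} → ReachableAvoidingV D a u → ReachableAvoidingA D a b u
  avoidVertex⇒avoidArc = mapWalk (λ _ → tt) (λ v≢a _ q → v≢a (proj₁ q))

  avoidingTail : ∀ {c a x z} (w : Walk D (AnyV D) (AnyA D) x z) → c ∉ vertices D w →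
                 Walk D (AnyV D) (NotArc c a) x z
  avoidingTail (nil _)        c∉w = nil tt
  avoidingTail (cons _ e _ w) c∉w =
    cons tt e (λ q → c∉w (here (sym (proj₁ q)))) (avoidingTail w (λ c∈w → c∉w (there c∈w)))

  arcHead≢root : ∀ {c a} → Arc D c a → ¬ (a ≡ root)
  arcHead≢root {c} c→a refl with trans (sym c→a) (root-indeg0 c)
  ... | ()

  cutEdge⇒cutVertex : Rule1 D → ∀ {a b} → CutEdge D a b → ¬ (a ≡ root) → CutVertex D a
  cutEdge⇒cutVertex r1 {a} (_ , u , u-cut) a≢root =
    a≢root , u , u≢a , λ w → u-cut (avoidVertex⇒avoidArc w)
    where
    u≢a : ¬ (u ≡ a)
    u≢a refl = u-cut (stopAtEnd (r1 u))

  -- Given a bypass reaching a without the arc c → a, any walk from a vertex x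
  -- reachable without that arc can be rerouted: each traversal of c → a is
  -- replaced by the bypass.
  reroute : ∀ {c a x z} → ReachableAvoidingA D c a a → ReachableAvoidingA D c a x →
            Walk D (AnyV D) (AnyA D) x z → ReachableAvoidingA D c a z
  reroute bypass acc (nil _) = acc
  reroute {c} {a} bypass acc (cons {x} {y} _ e _ rest) with x ≟ c | y ≟ a
  ... | yes refl | yes refl = reroute bypass bypass rest
  ... | no x≢c   | _        = reroute bypass (snoc acc tt e (λ q → x≢c (proj₁ q))) rest
  ... | yes _    | no y≢a   = reroute bypass (snoc acc tt e (λ q → y≢a (proj₂ q))) rest

  cutEdgeHead-needs-arc : Rule1 D → ∀ {c a} → CutEdge D c a → ¬ ReachableAvoidingA D c a a
  cutEdgeHead-needs-arc r1 (_ , u , u-cut) bypass = u-cut (reroute bypass (nil tt) (r1 u))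

  -- Under Rules 1 and 4, the tail c of a cut-edge c → a is the only
  -- in-neighbour of a: for another in-neighbour w, every path r ⇝ w meets c,
  -- which is exactly the configuration excluded by Rule 4.
  cutEdge⇒uniqueIn : Rule1 D → Rule4 D → ∀ {c a} → CutEdge D c a → ExactlyOneIn D a
  cutEdge⇒uniqueIn r1 r4 {c} {a} ca-cut@(c→a , _) =
    c , λ w → mk⇔ (onlyTail w) (λ { refl → c→a })
    where
    onlyTail : ∀ w → Arc D w a → w ≡ c
    onlyTail w w→a with w ≟ c
    ... | yes w≡c = w≡c
    ... | no w≢c  = ⊥-elim (r4 a w w→a pathsMeetTail)
      where
      pathsMeetTail : (P : Path D root w) →
                      Σ (V D) λ v → v ∈ vertices D (proj₁ P) × Arc D v a × ¬ (v ≡ w)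
      pathsMeetTail (p , _) with c ∈? vertices D p
      ... | yes c∈p = c , c∈p , c→a , λ c≡w → w≢c (sym c≡w)
      ... | no c∉p  = ⊥-elim (cutEdgeHead-needs-arc r1 ca-cut
                        (snoc (avoidingTail p c∉p) tt w→a (λ q → w≢c (proj₁ q))))

lemma12 : (D : RootedDigraph) → Reduced D →
    ∀ a b c d → CutEdge D a b → CutEdge D c d → ¬ ((a ≡ c) × (b ≡ d)) → ¬ (a ≡ d)
lemma12 D (r1 , r2 , _ , r4) a b c .a ab-cut ca-cut _ refl =
  proj₁ (r2 a aCutVertex) (cutEdge⇒uniqueIn D r1 r4 ca-cut)
  where
  aCutVertex : CutVertex D a
  aCutVertex = cutEdge⇒cutVertex D r1 ab-cut (arcHead≢root D (proj₁ ca-cut))
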